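{- Let $G$ be a graph and $x^0$ an optimal basic feasible solution of $\mathrm{ELP}(G)$. Let $(i,j)$ be an edge with $x^0_i+x^0_j=1$ that is contained in an odd cycle $\omega=(i,v_1,v_2,\ldots,v_k,j)$ of $G$. Then $\sum_{v\in\{v_1,\ldots,v_k\}} x^0_v\ge \lceil k/2\rceil$.
   Context: For a graph $H$, $\mathrm{ELP}(H)$ is the linear program: minimize $\sum_{v\in V(H)} x_v$ subject to $x_u+x_v\ge 1$ for every edge $(u,v)$ of $H$, $\sum_{v\in V(C)} x_v\ge s+1$ for every odd cycle $C$ of $H$ with $2s+1$ vertices, and $x\ge 0$. A basic feasible solution is a vertex of its feasible polyhedron. -}

module Defs where

open import Data.Nat as ℕ using (ℕ; zero; suc)
open import Data.Integer using (+_)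
open import Data.Fin using (Fin)
open import Data.List using (List; []; _∷_; map; foldr; foldl; length; allFin)
open import Data.List.Relation.Unary.Linked using (Linked)
open import Data.List.Relation.Unary.Unique.Propositional using (Unique)
open import Data.Rational using (ℚ; 0ℚ; 1ℚ; _+_; _*_; _-_; _≤_; _<_; _/_)
open import Data.Product using (_×_)
open import Data.Empty using (⊥)
open import Relation.Binary.PropositionalEquality using (_≡_)

record Graph (n : ℕ) : Set₁ where
  field
    Adj    : Fin n → Fin n → Set
    sym    : ∀ {u v} → Adj u v → Adj v u
    irrefl : ∀ {v} → Adj v v → ⊥
open Graph public

ℕ→ℚ : ℕ → ℚ
ℕ→ℚ k = (+ k) / 1

sumℚ : List ℚ → ℚ
sumℚ = foldr _+_ 0ℚ

lastOf : ∀ {A : Set} → A → List A → A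
lastOf c cs = foldl (λ _ y → y) c cs

IsCycle : ∀ {n} → Graph n → List (Fin n) → Set
IsCycle G []       = ⊥
IsCycle G (c ∷ cs) =
  Unique (c ∷ cs) × (3 ℕ.≤ length (c ∷ cs)) ×
  Linked (Adj G) (c ∷ cs) × Adj G (lastOf c cs) c

Feasible : ∀ {n} → Graph n → (Fin n → ℚ) → Set
Feasible {n} G x =
  (∀ v → 0ℚ ≤ x v) ×
  (∀ u v → Adj G u v → 1ℚ ≤ x u + x v) ×
  (∀ (C : List (Fin n)) (s : ℕ) → IsCycle G C → length C ≡ suc (2 ℕ.* s) →
     ℕ→ℚ (suc s) ≤ sumℚ (map x C))

objective : ∀ {n} → (Fin n → ℚ) → ℚ
objective {n} x = sumℚ (map x (allFin n))

Optimal : ∀ {n} → Graph n → (Fin n → ℚ) → Set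
Optimal G x = Feasible G x × (∀ y → Feasible G y → objective x ≤ objective y)

-- basic feasible solution = vertex (extreme point) of the feasible polyhedron:
-- x is not a proper convex combination of two distinct feasible points.
BasicFeasible : ∀ {n} → Graph n → (Fin n → ℚ) → Set
BasicFeasible G x =
  Feasible G x ×
  (∀ y z (λ′ : ℚ) → Feasible G y → Feasible G z → 0ℚ < λ′ → λ′ < 1ℚ →
     (∀ v → x v ≡ λ′ * y v + (1ℚ - λ′) * z v) → ∀ v → y v ≡ z v)

module Submission where

-- Feasibility of x⁰ for ELP(G) already forces the bound:
-- the cycle ω = i, v₁, …, v_k, j has 2s+1 vertices, so its odd-cycle
-- constraint gives  x_i + x_j + Σ_{v ∈ vs} x_v ≥ s + 1.  Since the edge (i,j)
-- is tight, x_i + x_j = 1, and cancelling 1 leaves Σ_{v ∈ vs} x_v ≥ s.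
-- Finally k + 2 = 2s + 1 means k is odd with ⌈k/2⌉ = s.

open import Defs hiding (sym)
open import Data.Nat using (ℕ; suc; _*_; ⌈_/2⌉)
open import Data.Fin using (Fin)
open import Data.List using (List; _∷_; _++_; [_]; length; map)
open import Data.Rational using (ℚ; _+_; _≤_; 1ℚ)
open import Relation.Binary.PropositionalEquality using (_≡_)

open import Data.List using ([])
open import Data.Product using (_,_; proj₂)
open import Data.Integer using (+_)
open import Data.Rational using (mkℚ; -_; 0ℚ; _/_)
import Data.Rational.Properties as ℚ
import Data.Nat as ℕ
import Data.Integer as ℤ
import Data.Integer.Properties as ℤ
import Data.Nat.Properties as ℕ
import Data.List.Properties as List
open import Data.Nat.Divisibility using (∣1⇒≡1)
open import Relation.Binary.PropositionalEquality
  using (refl; sym; cong; subst₂; module ≡-Reasoning)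
open ≡-Reasoning

ℕ→ℚ≡mkℚ : ∀ k → ℕ→ℚ k ≡ mkℚ (+ k) 0 (λ p → ∣1⇒≡1 (proj₂ p))
ℕ→ℚ≡mkℚ k = ℚ.normalize-coprime _

ℕ→ℚ-suc : ∀ k → ℕ→ℚ (suc k) ≡ 1ℚ + ℕ→ℚ k
ℕ→ℚ-suc k = sym (begin
  1ℚ + ℕ→ℚ k                        ≡⟨ cong (_+_ 1ℚ) (ℕ→ℚ≡mkℚ k) ⟩
  (+ 1 ℤ.+ + k ℤ.* + 1) / 1         ≡⟨ ℚ./-cong (cong (ℤ._+_ (+ 1)) (ℤ.*-identityʳ (+ k))) refl ⟩
  ℕ→ℚ (suc k)                       ∎)

+-cancelˡ-≤ : ∀ r {p q} → r + p ≤ r + q → p ≤ q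
+-cancelˡ-≤ r {p} {q} r+p≤r+q =
  subst₂ _≤_ (-r+[r+t]≡t p) (-r+[r+t]≡t q) (ℚ.+-monoʳ-≤ (- r) r+p≤r+q)
  where
  -r+[r+t]≡t : ∀ t → - r + (r + t) ≡ t
  -r+[r+t]≡t t = begin
    - r + (r + t)  ≡⟨ sym (ℚ.+-assoc (- r) r t) ⟩
    (- r + r) + t  ≡⟨ cong (_+ t) (ℚ.+-inverseˡ r) ⟩
    0ℚ + t         ≡⟨ ℚ.+-identityˡ t ⟩
    t              ∎

⌈/2⌉-of-odd : ∀ k s → suc k ≡ 2 * s → ⌈ k /2⌉ ≡ s
⌈/2⌉-of-odd k s k+1≡2s = begin
  ⌈ k /2⌉          ≡⟨ cong ℕ.⌊_/2⌋ k+1≡2s ⟩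
  ℕ.⌊ 2 * s /2⌋    ≡⟨ cong ℕ.⌊_/2⌋ (cong (ℕ._+_ s) (ℕ.+-identityʳ s)) ⟩
  ℕ.⌊ s ℕ.+ s /2⌋  ≡⟨ sym (ℕ.n≡⌊n+n/2⌋ s) ⟩
  s                ∎

sumℚ-++ : ∀ (ps qs : List ℚ) → sumℚ (ps ++ qs) ≡ sumℚ ps + sumℚ qs
sumℚ-++ []       qs = sym (ℚ.+-identityˡ (sumℚ qs))
sumℚ-++ (p ∷ ps) qs = begin
  p + sumℚ (ps ++ qs)       ≡⟨ cong (_+_ p) (sumℚ-++ ps qs) ⟩
  p + (sumℚ ps + sumℚ qs)   ≡⟨ sym (ℚ.+-assoc p (sumℚ ps) (sumℚ qs)) ⟩
  (p + sumℚ ps) + sumℚ qs   ∎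

cycle-weight : ∀ {n} (x : Fin n → ℚ) (i j : Fin n) (vs : List (Fin n)) →
  sumℚ (map x (i ∷ vs ++ [ j ])) ≡ (x i + x j) + sumℚ (map x vs)
cycle-weight x i j vs = begin
  x i + sumℚ (map x (vs ++ [ j ]))  ≡⟨ cong (λ t → x i + sumℚ t) (List.map-++ x vs [ j ]) ⟩
  x i + sumℚ (map x vs ++ [ x j ])  ≡⟨ cong (_+_ (x i)) (sumℚ-++ (map x vs) [ x j ]) ⟩
  x i + (S + (x j + 0ℚ))            ≡⟨ cong (λ t → x i + (S + t)) (ℚ.+-identityʳ (x j)) ⟩
  x i + (S + x j)                   ≡⟨ cong (_+_ (x i)) (ℚ.+-comm S (x j)) ⟩
  x i + (x j + S)                   ≡⟨ sym (ℚ.+-assoc (x i) (x j) S) ⟩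
  (x i + x j) + S                   ∎
  where S = sumℚ (map x vs)

tight-edge-odd-cycle : ∀ {n} (G : Graph n) (x : Fin n → ℚ) → Feasible G x →
  ∀ (i j : Fin n) → x i + x j ≡ 1ℚ →
  ∀ (vs : List (Fin n)) (s : ℕ) →
  IsCycle G (i ∷ vs ++ [ j ]) → length (i ∷ vs ++ [ j ]) ≡ suc (2 * s) →
  ℕ→ℚ s ≤ sumℚ (map x vs)
tight-edge-odd-cycle G x (_ , _ , odd-cycle) i j xi+xj≡1 vs s cycle length≡2s+1 =
  +-cancelˡ-≤ 1ℚ (split-off-tight-edge (odd-cycle (i ∷ vs ++ [ j ]) s cycle length≡2s+1))
  where
  -- the odd-cycle constraint, with s+1 = 1+s and the tight edge weight 1
  split-off-tight-edge : ℕ→ℚ (suc s) ≤ sumℚ (map x (i ∷ vs ++ [ j ])) →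
                         1ℚ + ℕ→ℚ s ≤ 1ℚ + sumℚ (map x vs)
  split-off-tight-edge rewrite ℕ→ℚ-suc s | cycle-weight x i j vs | xi+xj≡1 = λ bound → bound

interior-length : ∀ {A : Set} (i j : A) (vs : List A) (s : ℕ) →
  length (i ∷ vs ++ [ j ]) ≡ suc (2 * s) → suc (length vs) ≡ 2 * s
interior-length i j vs s length≡2s+1 = begin
  suc (length vs)        ≡⟨ ℕ.+-comm 1 (length vs) ⟩
  length vs ℕ.+ 1        ≡⟨ sym (List.length-++ vs) ⟩
  length (vs ++ [ j ])   ≡⟨ ℕ.suc-injective length≡2s+1 ⟩
  2 * s                  ∎

lemma2 : ∀ {n} (G : Graph n) (x : Fin n → ℚ) →
    Optimal G x → BasicFeasible G x →
    ∀ (i j : Fin n) → Adj G i j → x i + x j ≡ 1ℚ →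
    ∀ (vs : List (Fin n)) (s : ℕ) →
    IsCycle G (i ∷ vs ++ [ j ]) → length (i ∷ vs ++ [ j ]) ≡ suc (2 * s) →
    ℕ→ℚ ⌈ length vs /2⌉ ≤ sumℚ (map x vs)
lemma2 G x (feasible , _) _ i j _ xi+xj≡1 vs s cycle length≡2s+1
  rewrite ⌈/2⌉-of-odd (length vs) s (interior-length i j vs s length≡2s+1) =
  tight-edge-odd-cycle G x feasible i j xi+xj≡1 vs s cycle length≡2s+1
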